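{- Let $\sigma\in\{+,-\}^3$ and let $\sigma_r$ be its reversal. Then for all $n\geq 1$, $L_3^*(n;\sigma)=L_3^*(n;\sigma_r)$.
   Context: For $\sigma=\sigma^0\sigma^1\cdots\sigma^{k-1}\in\{+,-\}^k$, the reversal is $\sigma_r=\sigma^{k-1}\cdots\sigma^1\sigma^0$. A word of length $m$ on $k$ letters is $s=s_1\cdots s_m$ with $s_j\in\{0,\dots,k-1\}$; it is primitive if it is not the concatenation of $r>1$ copies of a single word. A necklace is an equivalence class of words under cyclic rotation, primitive if its representatives are. $L_k(m)$ is the number of primitive necklaces of length $m$ on $k$ letters. Let $T^-_\sigma=\{i:\sigma^i=-\}$ and $o_\sigma(s)=|\{j: s_j\in T^-_\sigma\}|$. $L_k(m;\sigma)$ is the number of primitive necklaces of length $m$ on $k$ letters whose representatives $s$ have $o_\sigma(s)$ odd, and $L_k^*(n;\sigma)=L_k(n)+L_k(n/2;\sigma)$ with $L_k(n/2;\sigma):=0$ for $n$ odd. -}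

module Defs where

open import Data.Bool using (Bool; true; false; _∧_; not; if_then_else_)
open import Data.Nat using (ℕ; zero; suc; _+_; _*_; _≡ᵇ_; _<ᵇ_; _%_; _/_)
open import Data.Fin using (Fin; toℕ)
open import Data.Vec as V using (Vec)
open import Data.List using (List; []; _∷_; [_]; _++_; map; concatMap; concat; replicate; take; drop; length; filterᵇ; upTo; allFin)

allᵇ : {A : Set} → (A → Bool) → List A → Bool
allᵇ p []       = true
allᵇ p (x ∷ xs) = p x ∧ allᵇ p xs

data Sign : Set where
  plus minus : Sign

Signs : ℕ → Set
Signs k = Vec Sign k

reversal : ∀ {k} → Signs k → Signs k
reversal = V.reverse

words : (k m : ℕ) → List (List (Fin k))
words k zero    = [ [] ]
words k (suc m) = concatMap (λ a → map (a ∷_) (words k m)) (allFin k)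

_==ᵂ_ : ∀ {k} → List (Fin k) → List (Fin k) → Bool
[]       ==ᵂ []       = true
(a ∷ as) ==ᵂ (b ∷ bs) = (toℕ a ≡ᵇ toℕ b) ∧ (as ==ᵂ bs)
_        ==ᵂ _        = false

-- a word s of length m is primitive iff it is not the concatenation of
-- r > 1 copies of a single word u; such a u necessarily has length d = m/r,
-- a proper divisor of m, and u = take d s.
isPrimitive : ∀ {k} → List (Fin k) → Bool
isPrimitive {k} s = allᵇ notPower (upTo m)
  where
  m = length s
  notPower : ℕ → Bool
  notPower zero    = true
  notPower (suc d) =
    if (m % suc d ≡ᵇ 0) ∧ (suc d <ᵇ m)
    then not (s ==ᵂ concat (replicate (m / suc d) (take (suc d) s)))
    else true

rotate : ∀ {k} → ℕ → List (Fin k) → List (Fin k)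
rotate i s = drop i s ++ take i s

_≤lex_ : ∀ {k} → List (Fin k) → List (Fin k) → Bool
[]       ≤lex _        = true
(_ ∷ _)  ≤lex []       = false
(a ∷ as) ≤lex (b ∷ bs) =
  if toℕ a <ᵇ toℕ b then true
  else if toℕ a ≡ᵇ toℕ b then as ≤lex bs
  else false

-- canonical representative of a necklace: the lexicographically least rotation.
-- Necklaces (rotation classes) are counted via these representatives.
isNecklaceRep : ∀ {k} → List (Fin k) → Bool
isNecklaceRep s = allᵇ (λ i → s ≤lex rotate i s) (upTo (length s))

L : (k m : ℕ) → ℕ
L k m = length (filterᵇ (λ s → isNecklaceRep s ∧ isPrimitive s) (words k m))

isMinus : Sign → Bool
isMinus plus  = false
isMinus minus = true

oσ : ∀ {k} → Signs k → List (Fin k) → ℕ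
oσ σ s = length (filterᵇ (λ a → isMinus (V.lookup σ a)) s)

isOdd : ℕ → Bool
isOdd n = n % 2 ≡ᵇ 1

-- L_k(m;σ): primitive necklaces of length m whose representatives have o_σ odd
-- (o_σ is rotation invariant, so it may be tested on the canonical representative)
Lσ : (k m : ℕ) → Signs k → ℕ
Lσ k m σ = length (filterᵇ (λ s → isNecklaceRep s ∧ isPrimitive s ∧ isOdd (oσ σ s)) (words k m))

L* : (k n : ℕ) → Signs k → ℕ
L* k n σ = L k n + (if n % 2 ≡ᵇ 0 then Lσ k (n / 2) σ else 0)

module Submission where

-- The letter involution a ↦ k − 1 − a (`opposite`) preserves primitivity and rotation classes and
-- turns o_σ into o_{σ_r}, so it matches the primitive necklaces counted by L_k(m;σ) with those
-- counted by L_k(m;σ_r); L_k(n) does not involve σ.  Necklaces are counted through their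
-- lexicographically least rotation, which the involution does not preserve.  This is repaired by
-- noting that the number of minimal-rotation representatives with a rotation-invariant property
-- does not depend on the total order used to pick them (minimal rotations for one order are in
-- bijection with those for another), and the involution maps the representatives for the
-- mirrored lexicographic order onto the lexicographic ones.

open import Defs
open import Data.Nat using (ℕ; _≥_)
open import Relation.Binary.PropositionalEquality using (_≡_)

open import Data.Bool using (Bool; true; false; T; _∧_; not; if_then_else_)
open import Data.Bool.Properties using (T-≡; T-∧)
open import Data.Fin using (Fin; toℕ; opposite; fromℕ; inject₁) renaming (zero to fzero; suc to fsuc)
open import Data.Fin.Properties using (toℕ-injective; opposite-involutive)
open import Data.List using (List; []; _∷_; [_]; _++_; map; concat; replicate; take; drop; length; filterᵇ; upTo; allFin)
import Data.List.Properties as List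
open import Data.List.Membership.Propositional using (_∈_)
open import Data.List.Membership.Propositional.Properties
  using (∈-map⁺; ∈-map⁻; ∈-filter⁺; ∈-filter⁻; ∈-upTo⁺; ∈-∃++; ∈-allFin; ∈-concatMap⁺; ∈-concatMap⁻)
open import Data.List.Relation.Unary.Any as Any using (here; there)
open import Data.List.Relation.Unary.All as All using ()
import Data.List.Relation.Unary.All.Properties as All
open import Data.List.Relation.Unary.AllPairs as AllPairs using ()
import Data.List.Relation.Unary.AllPairs.Properties as AllPairs
open import Data.List.Relation.Unary.Unique.Propositional using (Unique)
import Data.List.Relation.Unary.Unique.Propositional.Properties as Unique
open import Data.List.Relation.Binary.Disjoint.Propositional using (Disjoint)
open import Data.Nat using (zero; suc; _+_; _*_; _≤_; _<_; s≤s; z≤n; _%_; _/_; _≡ᵇ_; _<ᵇ_)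
open import Data.Nat.Properties
  using ( <-cmp; <⇒<ᵇ; <ᵇ⇒<; ≡⇒≡ᵇ; ≡ᵇ⇒≡; <-irrefl; <⇒≱; *-cancelʳ-<; *-identityˡ; ≤-refl; ≤-trans; ≤-antisym
        ; <⇒≤; +-comm; *-comm; m<m*n; m<n⇒0<n; m≤n⇒m<n∨m≡n; suc-injective)
open import Data.Nat.DivMod using (m≡m%n+[m/n]*n; m*n%n≡0; m*n/n≡m)
open import Data.Product using (_×_; _,_; proj₁; proj₂; ∃; ∃₂)
open import Data.Sum using (_⊎_; inj₁; inj₂)
open import Data.Vec as Vec using (Vec; _∷ʳ_)
import Data.Vec.Properties as Vec
open import Function using (_∘_; _⇔_; mk⇔; Equivalence)
open import Relation.Binary using (tri<; tri≈; tri>)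
open import Relation.Binary.PropositionalEquality using (refl; sym; trans; cong; cong₂; subst; subst₂; _≢_; module ≡-Reasoning)
open import Relation.Nullary using (¬_; contradiction; yes; no)
open import Relation.Nullary.Decidable using (T?)

open Equivalence using (to; from)

¬T⇔¬T⇒≡ : {a b : Bool} → (¬ T a → ¬ T b) → (¬ T b → ¬ T a) → a ≡ b
¬T⇔¬T⇒≡ {false} {false} _ _ = refl
¬T⇔¬T⇒≡ {false} {true}  f _ = contradiction _ (f (λ ()))
¬T⇔¬T⇒≡ {true}  {false} _ g = contradiction _ (g (λ ()))
¬T⇔¬T⇒≡ {true}  {true}  _ _ = refl

module _ {A : Set} (p : A → Bool) where

  allᵇ⁻ : ∀ xs → T (allᵇ p xs) → ∀ {x} → x ∈ xs → T (p x)
  allᵇ⁻ (y ∷ ys) t (here refl) = proj₁ (to T-∧ t)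
  allᵇ⁻ (y ∷ ys) t (there x∈)  = allᵇ⁻ ys (proj₂ (to T-∧ t)) x∈

  allᵇ⁺ : ∀ xs → (∀ {x} → x ∈ xs → T (p x)) → T (allᵇ p xs)
  allᵇ⁺ []       _ = _
  allᵇ⁺ (y ∷ ys) h = from T-∧ (h (here refl) , allᵇ⁺ ys (h ∘ there))

  ¬allᵇ⇒∃¬ : ∀ xs → ¬ T (allᵇ p xs) → ∃ λ x → x ∈ xs × ¬ T (p x)
  ¬allᵇ⇒∃¬ []       ¬all = contradiction _ ¬all
  ¬allᵇ⇒∃¬ (y ∷ ys) ¬all with T? (p y)
  ... | no ¬py = y , here refl , ¬py
  ... | yes py with ¬allᵇ⇒∃¬ ys (λ all → ¬all (from T-∧ (py , all)))
  ...   | x , x∈ , ¬px = x , there x∈ , ¬px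

length-filterᵇ-++ : {A : Set} (p : A → Bool) (u v : List A) →
                    length (filterᵇ p (u ++ v)) ≡ length (filterᵇ p u) + length (filterᵇ p v)
length-filterᵇ-++ p u v = trans (cong length (List.filter-++ (T? ∘ p) u v)) (List.length-++ (filterᵇ p u))

length-filterᵇ-map : {A B : Set} (f : A → B) (p : B → Bool) (q : A → Bool) → (∀ a → p (f a) ≡ q a) →
                     ∀ s → length (filterᵇ p (map f s)) ≡ length (filterᵇ q s)
length-filterᵇ-map f p q p∘f≡q []      = refl
length-filterᵇ-map f p q p∘f≡q (a ∷ s) rewrite p∘f≡q a with q a
... | true  = cong suc (length-filterᵇ-map f p q p∘f≡q s)
... | false = length-filterᵇ-map f p q p∘f≡q s

module _ {A : Set} where

  lookup-∷ʳ-last : ∀ {n} (xs : Vec A n) x → Vec.lookup (xs ∷ʳ x) (fromℕ n) ≡ x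
  lookup-∷ʳ-last Vec.[]       x = refl
  lookup-∷ʳ-last (y Vec.∷ xs) x = lookup-∷ʳ-last xs x

  lookup-∷ʳ-inject₁ : ∀ {n} (xs : Vec A n) x i → Vec.lookup (xs ∷ʳ x) (inject₁ i) ≡ Vec.lookup xs i
  lookup-∷ʳ-inject₁ (y Vec.∷ xs) x fzero    = refl
  lookup-∷ʳ-inject₁ (y Vec.∷ xs) x (fsuc i) = lookup-∷ʳ-inject₁ xs x i

  lookup-reverse-opposite : ∀ {n} (xs : Vec A n) i → Vec.lookup (Vec.reverse xs) (opposite i) ≡ Vec.lookup xs i
  lookup-reverse-opposite (x Vec.∷ xs) i rewrite Vec.reverse-∷ x xs with i
  ... | fzero  = lookup-∷ʳ-last (Vec.reverse xs) x
  ... | fsuc j = trans (lookup-∷ʳ-inject₁ (Vec.reverse xs) x (opposite j)) (lookup-reverse-opposite xs j)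

  lookup-opposite : ∀ {n} (xs : Vec A n) i → Vec.lookup xs (opposite i) ≡ Vec.lookup (Vec.reverse xs) i
  lookup-opposite xs i =
    trans (sym (lookup-reverse-opposite xs (opposite i))) (cong (Vec.lookup (Vec.reverse xs)) (opposite-involutive i))

module _ {A : Set} where

  Conjugate : List A → List A → Set
  Conjugate s t = ∃₂ λ (u v : List A) → s ≡ u ++ v × t ≡ v ++ u

  conjugate-refl : ∀ s → Conjugate s s
  conjugate-refl s = [] , s , refl , sym (List.++-identityʳ s)

  conjugate-sym : ∀ {s t} → Conjugate s t → Conjugate t s
  conjugate-sym (u , v , s≡uv , t≡vu) = v , u , t≡vu , s≡uv

  ++-≡-++ : ∀ x y v u → x ++ y ≡ v ++ u →
            (∃ λ (z : List A) → v ≡ x ++ z × y ≡ z ++ u) ⊎ (∃ λ (w : List A) → x ≡ v ++ w × u ≡ w ++ y)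
  ++-≡-++ []      y v       u eq = inj₁ (v , refl , eq)
  ++-≡-++ (a ∷ x) y []      u eq = inj₂ (a ∷ x , refl , sym eq)
  ++-≡-++ (a ∷ x) y (b ∷ v) u eq with List.∷-injective eq
  ... | refl , eq′ with ++-≡-++ x y v u eq′
  ...   | inj₁ (z , v≡xz , y≡zu) = inj₁ (z , cong (a ∷_) v≡xz , y≡zu)
  ...   | inj₂ (w , x≡vw , u≡wy) = inj₂ (w , cong (a ∷_) x≡vw , u≡wy)

  conjugate-trans : {s t r : List A} → Conjugate s t → Conjugate t r → Conjugate s r
  conjugate-trans (u , v , refl , refl) (x , y , vu≡xy , refl) with ++-≡-++ x y v u (sym vu≡xy)
  ... | inj₁ (z , refl , refl) = u ++ x , z , sym (List.++-assoc u x z) , List.++-assoc z u x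
  ... | inj₂ (w , refl , refl) = w , y ++ v , List.++-assoc w y v , sym (List.++-assoc y v w)

  take-length-++ : ∀ (u v : List A) → take (length u) (u ++ v) ≡ u
  take-length-++ []      v = refl
  take-length-++ (a ∷ u) v = cong (a ∷_) (take-length-++ u v)

  drop-length-++ : ∀ (u v : List A) → drop (length u) (u ++ v) ≡ v
  drop-length-++ []      v = refl
  drop-length-++ (a ∷ u) v = drop-length-++ u v

  conjugate-length : ∀ {s t} → Conjugate s t → length t ≡ length s
  conjugate-length (u , v , refl , refl) = List.length-++-comm v u

map-conjugate : {A B : Set} (f : A → B) {s t : List A} → Conjugate s t → Conjugate (map f s) (map f t)
map-conjugate f (u , v , refl , refl) = map f u , map f v , List.map-++ f u v , List.map-++ f v u

module _ {A : Set} where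

  power : List A → ℕ → List A
  power z n = concat (replicate n z)

  IsProperPower : List A → Set
  IsProperPower s = ∃₂ λ (z : List A) n → z ≢ [] × 2 ≤ n × s ≡ power z n

  length-power : ∀ z n → length (power z n) ≡ n * length z
  length-power z zero    = refl
  length-power z (suc n) = trans (List.length-++ z) (cong (length z +_) (length-power z n))

  power-++-comm : ∀ z n → power z n ++ z ≡ z ++ power z n
  power-++-comm z zero    = sym (List.++-identityʳ z)
  power-++-comm z (suc n) = trans (List.++-assoc z (power z n) z) (cong (z ++_) (power-++-comm z n))

  ++-power-shift : ∀ c a n → c ++ power (a ++ c) n ≡ power (c ++ a) n ++ c
  ++-power-shift c a zero    = List.++-identityʳ c
  ++-power-shift c a (suc n) = begin
    c ++ (a ++ c) ++ power (a ++ c) n   ≡⟨ cong (c ++_) (List.++-assoc a c _) ⟩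
    c ++ a ++ c ++ power (a ++ c) n     ≡⟨ List.++-assoc c a _ ⟨
    (c ++ a) ++ c ++ power (a ++ c) n   ≡⟨ cong ((c ++ a) ++_) (++-power-shift c a n) ⟩
    (c ++ a) ++ power (c ++ a) n ++ c   ≡⟨ List.++-assoc (c ++ a) _ c ⟨
    power (c ++ a) (suc n) ++ c         ∎
    where open ≡-Reasoning

  power-rotate₁ : ∀ x r z n → z ≢ [] → x ∷ r ≡ power z n → ∃ λ z′ → z′ ≢ [] × r ++ [ x ] ≡ power z′ n
  power-rotate₁ x r []      n       z≢[] _  = contradiction refl z≢[]
  power-rotate₁ x r (y ∷ z) (suc n) _    eq with List.∷-injective eq
  ... | refl , refl = z ++ [ x ] , (λ ()) ∘ List.++-conicalʳ z [ x ] , (begin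
    (z ++ power (x ∷ z) n) ++ [ x ]  ≡⟨ cong (_++ [ x ]) (++-power-shift z [ x ] n) ⟩
    (power (z ++ [ x ]) n ++ z) ++ [ x ]  ≡⟨ List.++-assoc (power (z ++ [ x ]) n) z [ x ] ⟩
    power (z ++ [ x ]) n ++ z ++ [ x ]    ≡⟨ power-++-comm (z ++ [ x ]) n ⟩
    power (z ++ [ x ]) (suc n)            ∎)
    where open ≡-Reasoning

  power-rotate : ∀ u v z n → z ≢ [] → u ++ v ≡ power z n → ∃ λ z′ → z′ ≢ [] × v ++ u ≡ power z′ n
  power-rotate []      v z n z≢[] eq = z , z≢[] , trans (List.++-identityʳ v) eq
  power-rotate (x ∷ u) v z n z≢[] eq with power-rotate₁ x (u ++ v) z n z≢[] eq
  ... | z″ , z″≢[] , eq″ with power-rotate u (v ++ [ x ]) z″ n z″≢[] (trans (sym (List.++-assoc u v [ x ])) eq″)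
  ...   | z′ , z′≢[] , eq′ = z′ , z′≢[] , trans (sym (List.++-assoc v [ x ] u)) eq′

  properPower-conjugate : ∀ {s t} → Conjugate s t → IsProperPower s → IsProperPower t
  properPower-conjugate (u , v , refl , refl) (z , n , z≢[] , 2≤n , eq) with power-rotate u v z n z≢[] eq
  ... | z′ , z′≢[] , eq′ = z′ , n , z′≢[] , 2≤n , eq′

  map-power : ∀ (f : A → A) z n → map f (power z n) ≡ power (map f z) n
  map-power f z n = trans (sym (List.concat-map (replicate n z))) (cong concat (List.map-replicate (map f) n z))

  properPower-map : ∀ (f : A → A) {s} → IsProperPower s → IsProperPower (map f s)
  properPower-map f ([]    , _ , z≢[] , _   , _)    = contradiction refl z≢[]
  properPower-map f (a ∷ z , n , _    , 2≤n , refl) = map f (a ∷ z) , n , (λ ()) , 2≤n , map-power f (a ∷ z) n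

module _ {X Y : Set} where

  ∈-++-∷⁻ : ∀ ys₁ ys₂ {w z : Y} → z ∈ ys₁ ++ w ∷ ys₂ → z ≢ w → z ∈ ys₁ ++ ys₂
  ∈-++-∷⁻ []        ys₂ (here refl) z≢w = contradiction refl z≢w
  ∈-++-∷⁻ []        ys₂ (there z∈)  z≢w = z∈
  ∈-++-∷⁻ (y ∷ ys₁) ys₂ (here refl) z≢w = here refl
  ∈-++-∷⁻ (y ∷ ys₁) ys₂ (there z∈)  z≢w = there (∈-++-∷⁻ ys₁ ys₂ z∈ z≢w)

  length-≤-by-injection : ∀ (f : X → Y) xs ys → Unique xs →
    (∀ {x} → x ∈ xs → f x ∈ ys) →
    (∀ {x y} → x ∈ xs → y ∈ xs → f x ≡ f y → x ≡ y) →
    length xs ≤ length ys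
  length-≤-by-injection f []       ys _ _ _ = z≤n
  length-≤-by-injection f (x ∷ xs) ys (x∉xs AllPairs.∷ xs!) into inj
    with ∈-∃++ (into (here refl))
  ... | ys₁ , ys₂ , refl =
    subst (suc (length xs) ≤_) (sym (List.length-++-sucʳ ys₁ (f x) ys₂))
      (s≤s (length-≤-by-injection f xs (ys₁ ++ ys₂) xs!
        (λ y∈ → ∈-++-∷⁻ ys₁ ys₂ (into (there y∈))
                  (λ fy≡fx → All.lookup x∉xs y∈ (inj (here refl) (there y∈) (sym fy≡fx))))
        (λ x∈ y∈ → inj (there x∈) (there y∈))))

module _ {X : Set} (W : List X) where

  Transfers : (X → Bool) → (X → Bool) → (X → X) → (X → X) → Set
  Transfers p q f g = ∀ {x} → x ∈ W → T (p x) → f x ∈ W × T (q (f x)) × g (f x) ≡ x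

  length-filterᵇ-≤ : Unique W → ∀ p q f g → Transfers p q f g → length (filterᵇ p W) ≤ length (filterᵇ q W)
  length-filterᵇ-≤ W! p q f g transfer =
    length-≤-by-injection f (filterᵇ p W) (filterᵇ q W) (Unique.filter⁺ (T? ∘ p) W!) into injective
    where
    into : ∀ {x} → x ∈ filterᵇ p W → f x ∈ filterᵇ q W
    into x∈ with ∈-filter⁻ (T? ∘ p) x∈
    ... | x∈W , px with transfer x∈W px
    ...   | fx∈W , qfx , _ = ∈-filter⁺ (T? ∘ q) fx∈W qfx
    retract : ∀ {x} → x ∈ filterᵇ p W → g (f x) ≡ x
    retract x∈ with ∈-filter⁻ (T? ∘ p) x∈
    ... | x∈W , px = proj₂ (proj₂ (transfer x∈W px))
    injective : ∀ {x y} → x ∈ filterᵇ p W → y ∈ filterᵇ p W → f x ≡ f y → x ≡ y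
    injective x∈ y∈ fx≡fy = trans (sym (retract x∈)) (trans (cong g fx≡fy) (retract y∈))

  length-filterᵇ-≡ : Unique W → ∀ p q f g → Transfers p q f g → Transfers q p g f →
                     length (filterᵇ p W) ≡ length (filterᵇ q W)
  length-filterᵇ-≡ W! p q f g p→q q→p =
    ≤-antisym (length-filterᵇ-≤ W! p q f g p→q) (length-filterᵇ-≤ W! q p g f q→p)

record BoolTotalOrder (X : Set) : Set where
  field
    _⊑_       : X → X → Bool
    ⊑-refl    : ∀ x → T (x ⊑ x)
    ⊑-trans   : ∀ x y z → T (x ⊑ y) → T (y ⊑ z) → T (x ⊑ z)
    ⊑-total   : ∀ x y → ¬ T (x ⊑ y) → T (y ⊑ x)
    ⊑-antisym : ∀ x y → T (x ⊑ y) → T (y ⊑ x) → x ≡ y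

pullback : {X Y : Set} (f : X → Y) → (∀ {x y} → f x ≡ f y → x ≡ y) → BoolTotalOrder Y → BoolTotalOrder X
pullback f f-injective O = record
  { _⊑_       = λ x y → f x ⊑ f y
  ; ⊑-refl    = λ x → ⊑-refl (f x)
  ; ⊑-trans   = λ x y z → ⊑-trans (f x) (f y) (f z)
  ; ⊑-total   = λ x y → ⊑-total (f x) (f y)
  ; ⊑-antisym = λ x y fx⊑fy fy⊑fx → f-injective (⊑-antisym (f x) (f y) fx⊑fy fy⊑fx)
  }
  where open BoolTotalOrder O

Word : ℕ → Set
Word k = List (Fin k)

module _ {k : ℕ} where

  rotate-conjugate : ∀ i (s : Word k) → Conjugate s (rotate i s)
  rotate-conjugate i s = take i s , drop i s , sym (List.take++drop≡id i s) , refl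

  conjugate⇒rotate : {s t : Word k} → Conjugate s t → ∃ λ i → i ≤ length s × t ≡ rotate i s
  conjugate⇒rotate (u , v , refl , refl) =
    length u , List.length-++-≤ˡ u , sym (cong₂ _++_ (drop-length-++ u v) (take-length-++ u v))

  rotate-length : (s : Word k) → rotate (length s) s ≡ s
  rotate-length s = cong₂ _++_ (List.drop-all (length s) s ≤-refl) (List.take-all (length s) s ≤-refl)

module MinimalRotation {k : ℕ} (O : BoolTotalOrder (Word k)) where
  open BoolTotalOrder O

  Minimal : Word k → Set
  Minimal s = ∀ t → Conjugate s t → T (s ⊑ t)

  Decides : (Word k → Bool) → Set
  Decides r = ∀ s → T (r s) ⇔ Minimal s

  minimal-unique : ∀ {s t} → Minimal s → Minimal t → Conjugate s t → s ≡ t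
  minimal-unique {s} {t} s-min t-min s∼t = ⊑-antisym s t (s-min t s∼t) (t-min s (conjugate-sym s∼t))

  minimum : Word k → List (Word k) → Word k
  minimum x []       = x
  minimum x (y ∷ ys) = if x ⊑ y then minimum x ys else minimum y ys

  minimum-∈ : ∀ x ys → minimum x ys ≡ x ⊎ minimum x ys ∈ ys
  minimum-∈ x [] = inj₁ refl
  minimum-∈ x (y ∷ ys) with x ⊑ y
  ... | true with minimum-∈ x ys
  ...   | inj₁ eq = inj₁ eq
  ...   | inj₂ m∈ = inj₂ (there m∈)
  minimum-∈ x (y ∷ ys) | false with minimum-∈ y ys
  ...   | inj₁ eq = inj₂ (here eq)
  ...   | inj₂ m∈ = inj₂ (there m∈)

  minimum-⊑ : ∀ x ys → T (minimum x ys ⊑ x) × (∀ {y} → y ∈ ys → T (minimum x ys ⊑ y))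
  minimum-⊑ x [] = ⊑-refl x , λ ()
  minimum-⊑ x (y ∷ ys) with x ⊑ y in x⊑y
  ... | true =
    let m⊑x , m⊑ys = minimum-⊑ x ys in
    m⊑x , λ { (here refl) → ⊑-trans _ x y m⊑x (from T-≡ x⊑y) ; (there y∈) → m⊑ys y∈ }
  ... | false =
    let m⊑y , m⊑ys = minimum-⊑ y ys in
    ⊑-trans _ y x m⊑y (⊑-total x y (subst T x⊑y)) , λ { (here refl) → m⊑y ; (there y∈) → m⊑ys y∈ }

  rotations : Word k → List (Word k)
  rotations s = map (λ i → rotate i s) (upTo (suc (length s)))

  conjugate⇒∈-rotations : ∀ {s t} → Conjugate s t → t ∈ rotations s
  conjugate⇒∈-rotations {s} s∼t with conjugate⇒rotate s∼t
  ... | i , i≤ , refl = ∈-map⁺ (λ i → rotate i s) (∈-upTo⁺ (s≤s i≤))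

  minimalRotation : Word k → Word k
  minimalRotation s = minimum s (rotations s)

  minimalRotation-conjugate : ∀ s → Conjugate s (minimalRotation s)
  minimalRotation-conjugate s with minimum-∈ s (rotations s)
  ... | inj₁ eq = subst (Conjugate s) (sym eq) (conjugate-refl s)
  ... | inj₂ m∈ with ∈-map⁻ (λ i → rotate i s) {xs = upTo (suc (length s))} m∈
  ...   | i , _ , eq = subst (Conjugate s) (sym eq) (rotate-conjugate i s)

  minimalRotation-minimal : ∀ s → Minimal (minimalRotation s)
  minimalRotation-minimal s t m∼t =
    proj₂ (minimum-⊑ s (rotations s)) (conjugate⇒∈-rotations (conjugate-trans (minimalRotation-conjugate s) m∼t))

module _ {k : ℕ} {W : List (Word k)} (W! : Unique W) (W-closed : ∀ {s t} → s ∈ W → Conjugate s t → t ∈ W)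
         (P : Word k → Bool) (P-invariant : ∀ {s t} → Conjugate s t → P s ≡ P t) where

  private
    transfer : ∀ O₁ O₂ r₁ r₂ → MinimalRotation.Decides O₁ r₁ → MinimalRotation.Decides O₂ r₂ →
               Transfers W (λ s → r₁ s ∧ P s) (λ s → r₂ s ∧ P s)
                 (MinimalRotation.minimalRotation O₂) (MinimalRotation.minimalRotation O₁)
    transfer O₁ O₂ r₁ r₂ r₁⇔ r₂⇔ {x} x∈W r₁x∧Px =
      W-closed x∈W x∼y ,
      from T-∧ (from (r₂⇔ y) (M₂.minimalRotation-minimal x) , subst T (P-invariant x∼y) (proj₂ (to T-∧ r₁x∧Px))) ,
      sym (M₁.minimal-unique (to (r₁⇔ x) (proj₁ (to T-∧ r₁x∧Px))) (M₁.minimalRotation-minimal y)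
                             (conjugate-trans x∼y (M₁.minimalRotation-conjugate y)))
      where
      module M₁ = MinimalRotation O₁
      module M₂ = MinimalRotation O₂
      y   = M₂.minimalRotation x
      x∼y = M₂.minimalRotation-conjugate x

  count-minimal-independent : ∀ O₁ O₂ r₁ r₂ → MinimalRotation.Decides O₁ r₁ → MinimalRotation.Decides O₂ r₂ →
    length (filterᵇ (λ s → r₁ s ∧ P s) W) ≡ length (filterᵇ (λ s → r₂ s ∧ P s) W)
  count-minimal-independent O₁ O₂ r₁ r₂ r₁⇔ r₂⇔ =
    length-filterᵇ-≡ W W! _ _ _ _ (transfer O₁ O₂ r₁ r₂ r₁⇔ r₂⇔) (transfer O₂ O₁ r₂ r₁ r₂⇔ r₁⇔)

module _ {k : ℕ} where

  ≤lex-< : ∀ {a b : Fin k} as bs → toℕ a < toℕ b → T ((a ∷ as) ≤lex (b ∷ bs))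
  ≤lex-< {a} {b} _ _ a<b with toℕ a <ᵇ toℕ b | <⇒<ᵇ a<b
  ... | true | _ = _

  ≤lex-> : ∀ {a b : Fin k} as bs → toℕ b < toℕ a → ¬ T ((a ∷ as) ≤lex (b ∷ bs))
  ≤lex-> {a} {b} _ _ b<a with toℕ a <ᵇ toℕ b in a<ᵇb | toℕ a ≡ᵇ toℕ b in a≡ᵇb
  ... | true  | _     = λ _ → <⇒≱ b<a (<⇒≤ (<ᵇ⇒< (toℕ a) (toℕ b) (from T-≡ a<ᵇb)))
  ... | false | true  = λ _ → <-irrefl (sym (≡ᵇ⇒≡ (toℕ a) (toℕ b) (from T-≡ a≡ᵇb))) b<a
  ... | false | false = λ ()

  ≤lex-≡ : ∀ (a : Fin k) as bs → (a ∷ as) ≤lex (a ∷ bs) ≡ as ≤lex bs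
  ≤lex-≡ a as bs with toℕ a <ᵇ toℕ a in a<ᵇa | toℕ a ≡ᵇ toℕ a | ≡⇒≡ᵇ (toℕ a) (toℕ a) refl
  ... | true  | _    | _ = contradiction (<ᵇ⇒< (toℕ a) (toℕ a) (from T-≡ a<ᵇa)) (<-irrefl refl)
  ... | false | true | _ = refl

  ≤lex-head : ∀ (a b : Fin k) as bs → T ((a ∷ as) ≤lex (b ∷ bs)) → toℕ a ≤ toℕ b
  ≤lex-head a b as bs s≤t with <-cmp (toℕ a) (toℕ b)
  ... | tri< a<b _ _ = <⇒≤ a<b
  ... | tri≈ _ a≡b _ = subst (toℕ a ≤_) a≡b ≤-refl
  ... | tri> _ _ b<a = contradiction s≤t (≤lex-> as bs b<a)

  ≤lex-refl : ∀ (s : Word k) → T (s ≤lex s)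
  ≤lex-refl []       = _
  ≤lex-refl (a ∷ as) = subst T (sym (≤lex-≡ a as as)) (≤lex-refl as)

  ≤lex-trans : ∀ (s t u : Word k) → T (s ≤lex t) → T (t ≤lex u) → T (s ≤lex u)
  ≤lex-trans []       _        _        _   _   = _
  ≤lex-trans (a ∷ as) (b ∷ bs) (c ∷ cs) s≤t t≤u with <-cmp (toℕ a) (toℕ c)
  ... | tri< a<c _ _ = ≤lex-< as cs a<c
  ... | tri> _ _ c<a = contradiction (≤-trans (≤lex-head a b as bs s≤t) (≤lex-head b c bs cs t≤u)) (<⇒≱ c<a)
  ... | tri≈ _ a≡c _ with toℕ-injective {i = a} {j = c} a≡c
  ...   | refl with toℕ-injective {i = a} {j = b} (≤-antisym (≤lex-head a b as bs s≤t) (≤lex-head b a bs cs t≤u))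
  ...     | refl = subst T (sym (≤lex-≡ a as cs))
                     (≤lex-trans as bs cs (subst T (≤lex-≡ a as bs) s≤t) (subst T (≤lex-≡ a bs cs) t≤u))

  ≤lex-total : ∀ (s t : Word k) → ¬ T (s ≤lex t) → T (t ≤lex s)
  ≤lex-total []       t        s≰t = contradiction _ s≰t
  ≤lex-total (a ∷ as) []       _   = _
  ≤lex-total (a ∷ as) (b ∷ bs) s≰t with <-cmp (toℕ a) (toℕ b)
  ... | tri< a<b _ _ = contradiction (≤lex-< as bs a<b) s≰t
  ... | tri> _ _ b<a = ≤lex-< bs as b<a
  ... | tri≈ _ a≡b _ with toℕ-injective {i = a} {j = b} a≡b
  ...   | refl = subst T (sym (≤lex-≡ a bs as)) (≤lex-total as bs (s≰t ∘ subst T (sym (≤lex-≡ a as bs))))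

  ≤lex-antisym : ∀ (s t : Word k) → T (s ≤lex t) → T (t ≤lex s) → s ≡ t
  ≤lex-antisym []       []       _   _   = refl
  ≤lex-antisym (a ∷ as) (b ∷ bs) s≤t t≤s
    with toℕ-injective {i = a} {j = b} (≤-antisym (≤lex-head a b as bs s≤t) (≤lex-head b a bs as t≤s))
  ... | refl = cong (a ∷_) (≤lex-antisym as bs (subst T (≤lex-≡ a as bs) s≤t) (subst T (≤lex-≡ a bs as) t≤s))

  lexOrder : BoolTotalOrder (Word k)
  lexOrder = record
    { _⊑_ = _≤lex_ ; ⊑-refl = ≤lex-refl ; ⊑-trans = ≤lex-trans ; ⊑-total = ≤lex-total ; ⊑-antisym = ≤lex-antisym }

module _ {k : ℕ} where

  open MinimalRotation (lexOrder {k}) using () renaming (Minimal to LexMinimal)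

  isNecklaceRep⇔lexMinimal : ∀ (s : Word k) → T (isNecklaceRep s) ⇔ LexMinimal s
  isNecklaceRep⇔lexMinimal s = mk⇔ minimal isRep
    where
    minimal : T (isNecklaceRep s) → LexMinimal s
    minimal rep t s∼t with conjugate⇒rotate s∼t
    ... | i , i≤ , refl with m≤n⇒m<n∨m≡n i≤
    ...   | inj₁ i< = allᵇ⁻ (λ i → s ≤lex rotate i s) (upTo (length s)) rep (∈-upTo⁺ i<)
    ...   | inj₂ refl = subst (λ r → T (s ≤lex r)) (sym (rotate-length s)) (≤lex-refl s)
    isRep : LexMinimal s → T (isNecklaceRep s)
    isRep min = allᵇ⁺ (λ i → s ≤lex rotate i s) (upTo (length s)) (λ {i} _ → min (rotate i s) (rotate-conjugate i s))

  mirror : Word k → Word k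
  mirror = map opposite

  mirror-involutive : ∀ s → mirror (mirror s) ≡ s
  mirror-involutive s = trans (sym (List.map-∘ s)) (trans (List.map-cong opposite-involutive s) (List.map-id s))

  mirror-injective : ∀ {s t} → mirror s ≡ mirror t → s ≡ t
  mirror-injective {s} {t} eq = trans (sym (mirror-involutive s)) (trans (cong mirror eq) (mirror-involutive t))

  mirrorLexOrder : BoolTotalOrder (Word k)
  mirrorLexOrder = pullback mirror mirror-injective lexOrder

  open MinimalRotation mirrorLexOrder using () renaming (Minimal to MirrorLexMinimal)

  isNecklaceRep-mirror⇔mirrorLexMinimal : ∀ s → T (isNecklaceRep (mirror s)) ⇔ MirrorLexMinimal s
  isNecklaceRep-mirror⇔mirrorLexMinimal s = mk⇔ minimal isRep
    where
    minimal : T (isNecklaceRep (mirror s)) → MirrorLexMinimal s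
    minimal rep t s∼t = to (isNecklaceRep⇔lexMinimal (mirror s)) rep (mirror t) (map-conjugate opposite s∼t)
    isRep : MirrorLexMinimal s → T (isNecklaceRep (mirror s))
    isRep min = from (isNecklaceRep⇔lexMinimal (mirror s)) λ t ms∼t →
      subst (λ r → T (mirror s ≤lex r)) (mirror-involutive t)
        (min (mirror t) (subst (λ r → Conjugate r (mirror t)) (mirror-involutive s) (map-conjugate opposite ms∼t)))

module _ {k : ℕ} where

  ==ᵂ⇒≡ : ∀ (s t : Word k) → T (s ==ᵂ t) → s ≡ t
  ==ᵂ⇒≡ []      []      _  = refl
  ==ᵂ⇒≡ (a ∷ s) (b ∷ t) eq =
    cong₂ _∷_ (toℕ-injective (≡ᵇ⇒≡ (toℕ a) (toℕ b) (proj₁ (to T-∧ eq)))) (==ᵂ⇒≡ s t (proj₂ (to T-∧ eq)))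

  ==ᵂ-refl : ∀ (s : Word k) → T (s ==ᵂ s)
  ==ᵂ-refl []      = _
  ==ᵂ-refl (a ∷ s) = from T-∧ (≡⇒≡ᵇ (toℕ a) (toℕ a) refl , ==ᵂ-refl s)

  -- The test `isPrimitive` performs for the candidate period suc d (definitionally).
  periodTest : Word k → ℕ → Bool
  periodTest s d =
    if (length s % suc d ≡ᵇ 0) ∧ (suc d <ᵇ length s)
    then not (s ==ᵂ power (take (suc d) s) (length s / suc d)) else true

  ¬periodTest⇒properPower : ∀ s d → ¬ T (periodTest s d) → IsProperPower s
  ¬periodTest⇒properPower s d ¬test
    with length s % suc d ≡ᵇ 0 in divides | suc d <ᵇ length s in proper
  ... | false | _     = contradiction _ ¬test
  ... | true  | false = contradiction _ ¬test
  ... | true  | true with s ==ᵂ power (take (suc d) s) (length s / suc d) in periodic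
  ...   | false = contradiction _ ¬test
  ...   | true  = take (suc d) s , n , nonempty , 2≤n , ==ᵂ⇒≡ _ _ (from T-≡ periodic)
    where
    n = length s / suc d
    d<|s| : suc d < length s
    d<|s| = <ᵇ⇒< (suc d) (length s) (from T-≡ proper)
    nonempty : take (suc d) s ≢ []
    nonempty = take-suc-nonempty s (m<n⇒0<n d<|s|)
      where
      take-suc-nonempty : ∀ (s : Word k) → 0 < length s → take (suc d) s ≢ []
      take-suc-nonempty (a ∷ _) _ ()
    |s|≡n*d : length s ≡ n * suc d
    |s|≡n*d = trans (m≡m%n+[m/n]*n (length s) (suc d)) (cong (_+ n * suc d) (≡ᵇ⇒≡ _ 0 (from T-≡ divides)))
    2≤n : 2 ≤ n
    2≤n = *-cancelʳ-< (suc d) 1 n (subst₂ _<_ (sym (*-identityˡ (suc d))) |s|≡n*d d<|s|)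

  periodic⇒¬periodTest : ∀ s d → length s % suc d ≡ 0 → suc d < length s →
                         s ≡ power (take (suc d) s) (length s / suc d) → ¬ T (periodTest s d)
  periodic⇒¬periodTest s d divides proper periodic
    rewrite divides | to T-≡ (<⇒<ᵇ proper) | to T-≡ (subst (λ r → T (s ==ᵂ r)) periodic (==ᵂ-refl s)) = λ ()

  ¬isPrimitive⇔properPower : ∀ (s : Word k) → (¬ T (isPrimitive s)) ⇔ IsProperPower s
  ¬isPrimitive⇔properPower s = mk⇔ properPower ¬primitive
    where
    properPower : ¬ T (isPrimitive s) → IsProperPower s
    properPower ¬prim with ¬allᵇ⇒∃¬ _ (upTo (length s)) ¬prim
    ... | zero  , _ , ¬test = contradiction _ ¬test
    ... | suc d , _ , ¬test = ¬periodTest⇒properPower s d ¬test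
    ¬primitive : IsProperPower s → ¬ T (isPrimitive s)
    ¬primitive ([]    , _ , z≢[] , _   , _)    = contradiction refl z≢[]
    ¬primitive (c ∷ z , n , _    , 2≤n , refl) prim =
      periodic⇒¬periodTest s d divides proper periodic (allᵇ⁻ _ (upTo (length s)) prim (∈-upTo⁺ proper))
      where
      d = length z
      |s|≡n*d : length s ≡ n * suc d
      |s|≡n*d = length-power (c ∷ z) n
      divides : length s % suc d ≡ 0
      divides = trans (cong (_% suc d) |s|≡n*d) (m*n%n≡0 n (suc d))
      proper : suc d < length s
      proper = subst (suc d <_) (trans (*-comm (suc d) n) (sym |s|≡n*d)) (m<m*n (suc d) n 2≤n)
      periodic : s ≡ power (take (suc d) s) (length s / suc d)
      periodic = sym (cong₂ power (take-power n 2≤n) (trans (cong (_/ suc d) |s|≡n*d) (m*n/n≡m n (suc d))))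
        where
        take-power : ∀ n → 2 ≤ n → take (suc d) (power (c ∷ z) n) ≡ c ∷ z
        take-power (suc n) _ = take-length-++ (c ∷ z) (power (c ∷ z) n)

  isPrimitive-cong : ∀ {s t : Word k} → (IsProperPower s → IsProperPower t) → (IsProperPower t → IsProperPower s) →
                     isPrimitive s ≡ isPrimitive t
  isPrimitive-cong {s} {t} s→t t→s = ¬T⇔¬T⇒≡
    (from (¬isPrimitive⇔properPower t) ∘ s→t ∘ to (¬isPrimitive⇔properPower s))
    (from (¬isPrimitive⇔properPower s) ∘ t→s ∘ to (¬isPrimitive⇔properPower t))

  isPrimitive-conjugate : ∀ {s t : Word k} → Conjugate s t → isPrimitive s ≡ isPrimitive t
  isPrimitive-conjugate s∼t = isPrimitive-cong (properPower-conjugate s∼t) (properPower-conjugate (conjugate-sym s∼t))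

  isPrimitive-mirror : ∀ (s : Word k) → isPrimitive (mirror s) ≡ isPrimitive s
  isPrimitive-mirror s = isPrimitive-cong
    (subst IsProperPower (mirror-involutive s) ∘ properPower-map opposite) (properPower-map opposite)

module _ {k : ℕ} where

  ∈-words⇔ : ∀ m (s : Word k) → s ∈ words k m ⇔ length s ≡ m
  ∈-words⇔ m s = mk⇔ (length-∈ m) (∈-words m s)
    where
    length-∈ : ∀ m {s} → s ∈ words k m → length s ≡ m
    length-∈ zero    (here refl) = refl
    length-∈ (suc m) s∈ with Any.satisfied (∈-concatMap⁻ (λ a → map (a ∷_) (words k m)) {xs = allFin k} s∈)
    ... | a , s∈a∷ with ∈-map⁻ (a ∷_) s∈a∷
    ...   | s′ , s′∈ , refl = cong suc (length-∈ m s′∈)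
    ∈-words : ∀ m s → length s ≡ m → s ∈ words k m
    ∈-words zero    []      _  = here refl
    ∈-words (suc m) (a ∷ s) eq = ∈-concatMap⁺ (λ a → map (a ∷_) (words k m))
      (Any.map (λ { refl → ∈-map⁺ (a ∷_) (∈-words m s (suc-injective eq)) }) (∈-allFin a))

  words-unique : ∀ m → Unique (words k m)
  words-unique zero    = All.[] AllPairs.∷ AllPairs.[]
  words-unique (suc m) = Unique.concat⁺
    (All.map⁺ (All.tabulate (λ _ → Unique.map⁺ List.∷-injectiveʳ (words-unique m))))
    (AllPairs.map⁺ (AllPairs.map disjoint (Unique.allFin⁺ k)))
    where
    disjoint : ∀ {a b} → a ≢ b → Disjoint (map (a ∷_) (words k m)) (map (b ∷_) (words k m))
    disjoint a≢b (s∈a∷ , s∈b∷) with ∈-map⁻ _ s∈a∷ | ∈-map⁻ _ s∈b∷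
    ... | _ , _ , refl | _ , _ , eq = a≢b (List.∷-injectiveˡ eq)

  words-conjugate-closed : ∀ m {s t} → s ∈ words k m → Conjugate s t → t ∈ words k m
  words-conjugate-closed m {s} {t} s∈ s∼t = from (∈-words⇔ m t) (trans (conjugate-length s∼t) (to (∈-words⇔ m s) s∈))

  words-mirror-closed : ∀ m {s} → s ∈ words k m → mirror s ∈ words k m
  words-mirror-closed m {s} s∈ = from (∈-words⇔ m (mirror s)) (trans (List.length-map opposite s) (to (∈-words⇔ m s) s∈))

module _ {k : ℕ} (σ : Signs k) where

  oσ-conjugate : ∀ {s t} → Conjugate s t → oσ σ s ≡ oσ σ t
  oσ-conjugate (u , v , refl , refl) = begin
    length (filterᵇ p (u ++ v))                    ≡⟨ length-filterᵇ-++ p u v ⟩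
    length (filterᵇ p u) + length (filterᵇ p v)    ≡⟨ +-comm (length (filterᵇ p u)) _ ⟩
    length (filterᵇ p v) + length (filterᵇ p u)    ≡⟨ length-filterᵇ-++ p v u ⟨
    length (filterᵇ p (v ++ u))                    ∎
    where
    open ≡-Reasoning
    p = λ a → isMinus (Vec.lookup σ a)

  oσ-mirror : ∀ s → oσ σ (mirror s) ≡ oσ (reversal σ) s
  oσ-mirror = length-filterᵇ-map opposite _ _ (λ a → cong isMinus (lookup-opposite σ a))

primitiveOdd : ∀ {k} → Signs k → Word k → Bool
primitiveOdd σ s = isPrimitive s ∧ isOdd (oσ σ s)

module _ {k : ℕ} (σ : Signs k) where

  primitiveOdd-conjugate : ∀ {s t} → Conjugate s t → primitiveOdd σ s ≡ primitiveOdd σ t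
  primitiveOdd-conjugate s∼t = cong₂ _∧_ (isPrimitive-conjugate s∼t) (cong isOdd (oσ-conjugate σ s∼t))

  primitiveOdd-mirror : ∀ s → primitiveOdd σ (mirror s) ≡ primitiveOdd (reversal σ) s
  primitiveOdd-mirror s = cong₂ _∧_ (isPrimitive-mirror s) (cong isOdd (oσ-mirror σ s))

Lσ-reversal : ∀ k m (σ : Signs k) → Lσ k m σ ≡ Lσ k m (reversal σ)
Lσ-reversal k m σ = begin
  length (filterᵇ (λ s → isNecklaceRep s ∧ primitiveOdd σ s) W)
    ≡⟨ count-minimal-independent (words-unique m) (words-conjugate-closed m) (primitiveOdd σ) (primitiveOdd-conjugate σ)
         lexOrder mirrorLexOrder isNecklaceRep (isNecklaceRep ∘ mirror)
         isNecklaceRep⇔lexMinimal isNecklaceRep-mirror⇔mirrorLexMinimal ⟩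
  length (filterᵇ mirroredRep W)
    ≡⟨ length-filterᵇ-≡ W (words-unique m) mirroredRep reversedRep mirror mirror to-reversed to-mirrored ⟩
  length (filterᵇ reversedRep W)
    ∎
  where
  open ≡-Reasoning
  W  = words k m
  σᵣ = reversal σ
  mirroredRep reversedRep : Word k → Bool
  mirroredRep s = isNecklaceRep (mirror s) ∧ primitiveOdd σ s
  reversedRep s = isNecklaceRep s ∧ primitiveOdd σᵣ s

  to-reversed : Transfers W mirroredRep reversedRep mirror mirror
  to-reversed {x} x∈ t = words-mirror-closed m x∈ , subst T (cong (isNecklaceRep (mirror x) ∧_) odd≡) t , mirror-involutive x
    where
    odd≡ : primitiveOdd σ x ≡ primitiveOdd σᵣ (mirror x)
    odd≡ = trans (cong (primitiveOdd σ) (sym (mirror-involutive x))) (primitiveOdd-mirror σ (mirror x))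

  to-mirrored : Transfers W reversedRep mirroredRep mirror mirror
  to-mirrored {y} y∈ t = words-mirror-closed m y∈ , subst T (sym rep≡) t , mirror-involutive y
    where
    rep≡ : mirroredRep (mirror y) ≡ reversedRep y
    rep≡ = cong₂ _∧_ (cong isNecklaceRep (mirror-involutive y)) (primitiveOdd-mirror σ y)

mainTheorem9 : (σ : Signs 3) (n : ℕ) → n ≥ 1 → L* 3 n σ ≡ L* 3 n (reversal σ)
mainTheorem9 σ n _ = cong (λ x → L 3 n + (if n % 2 ≡ᵇ 0 then x else 0)) (Lσ-reversal 3 (n / 2) σ)
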